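{- Let $p$ be a prime with $p\equiv1\pmod4$, let $u_p=(t+b\sqrt p)/2>1$ ($t,b$ positive integers) be the fundamental unit of $\mathbb Q(\sqrt p)$, and let $A,B$ be integers with $p=A^2+B^2$, $A\equiv-1\pmod4$ and $p\mid At+2B$. Then $bp\ge|At+2B|$ and $bp\ge|At-2B|$. -}

module Defs where

open import Data.Nat as ℕ using (ℕ)
open import Data.Integer using (ℤ; +_; -[1+_]; _+_; _-_; _*_; -_; _≤_; _<_)
open import Data.Product using (_×_)
open import Data.Sum using (_⊎_)
open import Relation.Binary.PropositionalEquality using (_≡_)

-- For integers x, y and a natural p, the real-number inequality  x ≤ y·√p,
-- decided by signs and squaring (no reals in the library).
LeSqrt : ℕ → ℤ → ℤ → Set
LeSqrt p x y =
    (x ≤ + 0 × + 0 ≤ y)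
  ⊎ ((x ≤ + 0 × y < + 0) × (+ p * (y * y) ≤ x * x))
  ⊎ ((+ 0 < x × + 0 ≤ y) × (x * x ≤ + p * (y * y)))

-- (t + b√p)/2 ≤ (t' + b'√p)/2  as real numbers.
UnitLe : ℕ → ℤ → ℤ → ℤ → ℤ → Set
UnitLe p t b t' b' = LeSqrt p (t - t') (b' - b)

-- (t + b√p)/2 is a unit of the ring of integers of Q(√p) (p ≡ 1 mod 4):
-- its norm (t² − p b²)/4 is ±1.
IsUnit : ℕ → ℤ → ℤ → Set
IsUnit p t b = (t * t - + p * (b * b) ≡ + 4) ⊎ (t * t - + p * (b * b) ≡ - + 4)

-- (t + b√p)/2 > 1 with t, b positive, a unit, and the least unit > 1.
-- (Every unit > 1 has t, b > 0, so minimality over positive t', b' is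
-- minimality over all units > 1.)
IsFundamentalUnit : ℕ → ℤ → ℤ → Set
IsFundamentalUnit p t b =
  (+ 0 < t) × (+ 0 < b) × IsUnit p t b ×
  ((t' b' : ℤ) → + 0 < t' → + 0 < b' → IsUnit p t' b' → UnitLe p t b t' b')

-- Brahmagupta's identity gives (At ± 2B)² + (2A ∓ Bt)² = (A² + B²)(t² + 4) = p(t² + 4).
-- If the fundamental unit has norm −1, i.e. t² − pb² = −4, the right-hand side is (bp)²,
-- which bounds |At ± 2B| by bp. Norm +1 is excluded by p ∣ At + 2B: then t² ≡ 4 and
-- B² ≡ −A² (mod p), so p divides (At + 2B)(At − 2B) + 8B² = A²t² + 4B² and hence 8B²;
-- thus p ∣ B, which is impossible for a prime p = A² + B².
module Submission where

open import Defs
open import Data.Nat using (ℕ; _%_)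
open import Data.Nat.Primality using (Prime)
open import Data.Integer using (ℤ; +_; _+_; _-_; _*_; _≤_; ∣_∣)
open import Data.Integer.Divisibility using (_∣_)
open import Relation.Binary.PropositionalEquality using (_≡_)
open import Data.Product using (_×_)

import Data.Nat as ℕ
import Data.Nat.Properties as ℕ
import Data.Nat.Divisibility as ℕ
open import Data.Nat.Primality using (euclidsLemma; irreducible[2]; ¬prime[1]; prime⇒nonZero)
open import Data.Integer using (-[1+_]; -_; +≤+)
open import Data.Integer.Properties using (i≡j⇒i-j≡0; pos-*; pos-+; +-injective; abs-*; <⇒≤; *-monoʳ-≤-nonNeg)
import Data.Integer.Divisibility.Signed as ℤ
open import Data.Integer.Tactic.RingSolver using (solve-∀)
open import Data.Empty using (⊥-elim)
open import Data.Product using (_,_)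
open import Data.Sum using (inj₁; inj₂; [_,_]′; reduce)
open import Function using (id)
open import Relation.Nullary using (¬_; contradiction)
open import Relation.Binary.PropositionalEquality using (refl; sym; trans; cong; cong₂; subst; _≢_; module ≡-Reasoning)

m*m≤n*n⇒m≤n : ∀ m n → m ℕ.* m ℕ.≤ n ℕ.* n → m ℕ.≤ n
m*m≤n*n⇒m≤n m n m*m≤n*n = ℕ.≮⇒≥ λ n<m → ℕ.<⇒≱ (ℕ.*-mono-< n<m n<m) m*m≤n*n

prime∣2⇒≡2 : ∀ {p} → Prime p → p ℕ.∣ 2 → p ≡ 2
prime∣2⇒≡2 pr p∣2 =
  [ (λ p≡1 → contradiction (subst Prime p≡1 pr) ¬prime[1]) , id ]′ (irreducible[2] p∣2)

prime∣8⇒≡2 : ∀ {p} → Prime p → p ℕ.∣ 8 → p ≡ 2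
prime∣8⇒≡2 pr p∣8 = prime∣2⇒≡2 pr
  ([ id , (λ p∣4 → reduce (euclidsLemma 2 2 pr p∣4)) ]′ (euclidsLemma 2 4 pr p∣8))

prime≢2∧∣8*n*n⇒∣n : ∀ {p} n → Prime p → p ≢ 2 → p ℕ.∣ 8 ℕ.* (n ℕ.* n) → p ℕ.∣ n
prime≢2∧∣8*n*n⇒∣n n pr p≢2 p∣8n² =
  [ (λ p∣8 → contradiction (prime∣8⇒≡2 pr p∣8) p≢2) , (λ p∣n² → reduce (euclidsLemma n n pr p∣n²)) ]′
    (euclidsLemma 8 (n ℕ.* n) pr p∣8n²)

%4≡1⇒≢2 : ∀ {p} → p % 4 ≡ 1 → p ≢ 2
%4≡1⇒≢2 () refl

-- p² would divide m² + n² = p.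
prime≡m*m+n*n⇒∤n : ∀ {p} m n → Prime p → p ≡ m ℕ.* m ℕ.+ n ℕ.* n → ¬ p ℕ.∣ n
prime≡m*m+n*n⇒∤n {p} m n pr p≡m²+n² p∣n = contradiction (subst Prime p≡1 pr) ¬prime[1]
  where
  instance _ = prime⇒nonZero pr
  p∣n² : p ℕ.∣ n ℕ.* n
  p∣n² = ℕ.∣m⇒∣m*n n p∣n
  p∣m : p ℕ.∣ m
  p∣m = reduce (euclidsLemma m m pr (ℕ.∣m+n∣m⇒∣n
    (subst (p ℕ.∣_) (trans p≡m²+n² (ℕ.+-comm (m ℕ.* m) (n ℕ.* n))) ℕ.∣-refl) p∣n²))
  p*p∣p*1 : p ℕ.* p ℕ.∣ p ℕ.* 1
  p*p∣p*1 = subst (p ℕ.* p ℕ.∣_) (trans (sym p≡m²+n²) (sym (ℕ.*-identityʳ p)))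
    (ℕ.∣m∣n⇒∣m+n (ℕ.*-pres-∣ p∣m p∣m) (ℕ.*-pres-∣ p∣n p∣n))
  p≡1 : p ≡ 1
  p≡1 = ℕ.∣1⇒≡1 (ℕ.*-cancelˡ-∣ p p*p∣p*1)

i*i≡+∣i∣*∣i∣ : ∀ i → i * i ≡ + (∣ i ∣ ℕ.* ∣ i ∣)
i*i≡+∣i∣*∣i∣ (+ n)    = sym (pos-* n n)
i*i≡+∣i∣*∣i∣ -[1+ n ] = refl

i*i+j*j≡+∣i∣*∣i∣+∣j∣*∣j∣ : ∀ i j → i * i + j * j ≡ + (∣ i ∣ ℕ.* ∣ i ∣ ℕ.+ ∣ j ∣ ℕ.* ∣ j ∣)
i*i+j*j≡+∣i∣*∣i∣+∣j∣*∣j∣ i j =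
  trans (cong₂ _+_ (i*i≡+∣i∣*∣i∣ i) (i*i≡+∣i∣*∣i∣ j)) (sym (pos-+ (∣ i ∣ ℕ.* ∣ i ∣) (∣ j ∣ ℕ.* ∣ j ∣)))

i*i+j*j≡k*k⇒∣i∣≤k : ∀ i j k → + 0 ≤ k → i * i + j * j ≡ k * k → + ∣ i ∣ ≤ k
i*i+j*j≡k*k⇒∣i∣≤k i j (+ n) _ i²+j²≡n² = +≤+ (m*m≤n*n⇒m≤n ∣ i ∣ n
  (subst (∣ i ∣ ℕ.* ∣ i ∣ ℕ.≤_) ∣i∣²+∣j∣²≡n² (ℕ.m≤m+n (∣ i ∣ ℕ.* ∣ i ∣) (∣ j ∣ ℕ.* ∣ j ∣))))
  where
  ∣i∣²+∣j∣²≡n² : ∣ i ∣ ℕ.* ∣ i ∣ ℕ.+ ∣ j ∣ ℕ.* ∣ j ∣ ≡ n ℕ.* n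
  ∣i∣²+∣j∣²≡n² = +-injective
    (trans (sym (i*i+j*j≡+∣i∣*∣i∣+∣j∣*∣j∣ i j)) (trans i²+j²≡n² (i*i≡+∣i∣*∣i∣ (+ n))))

-- The ring identities below are arranged so that each hypothesis enters as a vanishing factor.
u*x+v*y+z≡z : ∀ {x y} u v z → x ≡ + 0 → y ≡ + 0 → u * x + v * y + z ≡ z
u*x+v*y+z≡z u v z refl refl = u*0+v*0+z≡z u v z
  where
  u*0+v*0+z≡z : ∀ u v z → u * + 0 + v * + 0 + z ≡ z
  u*0+v*0+z≡z = solve-∀

brahmagupta⁺ : ∀ a b c d →
  (a * c + d * b) * (a * c + d * b) + (d * a - b * c) * (d * a - b * c) ≡ (a * a + b * b) * (c * c + d * d)
brahmagupta⁺ = solve-∀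

brahmagupta⁻ : ∀ a b c d →
  (a * c - d * b) * (a * c - d * b) + (d * a + b * c) * (d * a + b * c) ≡ (a * a + b * b) * (c * c + d * d)
brahmagupta⁻ = solve-∀

module _ (P A B t b : ℤ) (P≡A²+B² : P ≡ A * A + B * B) where

  A²+B²-P≡0 : A * A + B * B - P ≡ + 0
  A²+B²-P≡0 = i≡j⇒i-j≡0 (sym P≡A²+B²)

  norm≡-4⇒[A²+B²][t²+4]≡[bP]² : t * t - P * (b * b) ≡ - + 4 →
    (A * A + B * B) * (t * t + + 4) ≡ (b * P) * (b * P)
  norm≡-4⇒[A²+B²][t²+4]≡[bP]² norm≡-4 = begin
    (A * A + B * B) * (t * t + + 4)
      ≡⟨ expand A B t b P ⟩
    (A * A + B * B) * (t * t - P * (b * b) + + 4) + P * (b * b) * (A * A + B * B - P) + (b * P) * (b * P)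
      ≡⟨ u*x+v*y+z≡z (A * A + B * B) (P * (b * b)) ((b * P) * (b * P)) (cong (_+ + 4) norm≡-4) A²+B²-P≡0 ⟩
    (b * P) * (b * P) ∎
    where
    open ≡-Reasoning
    expand : ∀ A B t b P → (A * A + B * B) * (t * t + + 4) ≡
      (A * A + B * B) * (t * t - P * (b * b) + + 4) + P * (b * b) * (A * A + B * B - P) + (b * P) * (b * P)
    expand = solve-∀

  norm≡4⇒P∣8B² : t * t - P * (b * b) ≡ + 4 → P ℤ.∣ A * t + + 2 * B → P ℤ.∣ + 8 * (B * B)
  norm≡4⇒P∣8B² norm≡4 P∣At+2B = ℤ.∣m+n∣m⇒∣n (subst (P ℤ.∣_) (sym product≡) (ℤ.∣m⇒∣m*n _ ℤ.∣-refl))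
    (ℤ.∣m⇒∣m*n (A * t - + 2 * B) P∣At+2B)
    where
    open ≡-Reasoning
    expand : ∀ A B t b P → (A * t + + 2 * B) * (A * t - + 2 * B) + + 8 * (B * B) ≡
      A * A * (t * t - P * (b * b) - + 4) + + 4 * (A * A + B * B - P) + P * (A * A * (b * b) + + 4)
    expand = solve-∀
    product≡ : (A * t + + 2 * B) * (A * t - + 2 * B) + + 8 * (B * B) ≡ P * (A * A * (b * b) + + 4)
    product≡ = begin
      (A * t + + 2 * B) * (A * t - + 2 * B) + + 8 * (B * B)
        ≡⟨ expand A B t b P ⟩
      A * A * (t * t - P * (b * b) - + 4) + + 4 * (A * A + B * B - P) + P * (A * A * (b * b) + + 4)
        ≡⟨ u*x+v*y+z≡z (A * A) (+ 4) (P * (A * A * (b * b) + + 4)) (cong (_- + 4) norm≡4) A²+B²-P≡0 ⟩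
      P * (A * A * (b * b) + + 4) ∎

norm≢4 : ∀ {p} t b A B → Prime p → p % 4 ≡ 1 → + p ≡ A * A + B * B →
  + p ∣ A * t + + 2 * B → t * t - + p * (b * b) ≢ + 4
norm≢4 {p} t b A B pr p%4≡1 hp p∣At+2B norm≡4 =
  prime≡m*m+n*n⇒∤n ∣ A ∣ ∣ B ∣ pr (+-injective (trans hp (i*i+j*j≡+∣i∣*∣i∣+∣j∣*∣j∣ A B)))
    (prime≢2∧∣8*n*n⇒∣n ∣ B ∣ pr (%4≡1⇒≢2 p%4≡1)
      (subst (p ℕ.∣_) (trans (abs-* (+ 8) (B * B)) (cong (8 ℕ.*_) (abs-* B B)))
        (ℤ.∣⇒∣ᵤ (norm≡4⇒P∣8B² (+ p) A B t b hp norm≡4 (ℤ.∣ᵤ⇒∣ p∣At+2B)))))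

lemma5 : (p : ℕ) → Prime p → p % 4 ≡ 1 →
         (t b : ℤ) → IsFundamentalUnit p t b →
         (A B : ℤ) → + p ≡ A * A + B * B → + 4 ∣ A + + 1 →
         + p ∣ A * t + + 2 * B →
         (+ ∣ A * t + + 2 * B ∣ ≤ b * + p) × (+ ∣ A * t - + 2 * B ∣ ≤ b * + p)
lemma5 p pr p%4≡1 t b (_ , 0<b , isUnit , _) A B hp _ p∣At+2B with isUnit
... | inj₁ norm≡4  = ⊥-elim (norm≢4 t b A B pr p%4≡1 hp p∣At+2B norm≡4)
... | inj₂ norm≡-4 =
  i*i+j*j≡k*k⇒∣i∣≤k (A * t + + 2 * B) (+ 2 * A - B * t) (b * + p) 0≤bp
    (trans (brahmagupta⁺ A B t (+ 2)) [A²+B²][t²+4]≡[bp]²) ,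
  i*i+j*j≡k*k⇒∣i∣≤k (A * t - + 2 * B) (+ 2 * A + B * t) (b * + p) 0≤bp
    (trans (brahmagupta⁻ A B t (+ 2)) [A²+B²][t²+4]≡[bp]²)
  where
  0≤bp : + 0 ≤ b * + p
  0≤bp = *-monoʳ-≤-nonNeg (+ p) (<⇒≤ 0<b)
  [A²+B²][t²+4]≡[bp]² : (A * A + B * B) * (t * t + + 4) ≡ (b * + p) * (b * + p)
  [A²+B²][t²+4]≡[bp]² = norm≡-4⇒[A²+B²][t²+4]≡[bP]² (+ p) A B t b hp norm≡-4
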